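{- Let $k\ge 1$. For every $n\ge k+1$, the coefficient of $x^{n-k}$ in $R_n^{(k\le\max,\emptyset,0,0)}(x)$ equals $(k-1)!$.
   Context: For $\sigma=\sigma_1\cdots\sigma_n\in S_n$, $\sigma_i$ matches $MMP(k\le\max,\emptyset,0,0)$ if no $j<i$ has $\sigma_j>\sigma_i$, and, with $\sigma_m=\max\{\sigma_{i+1},\dots,\sigma_n\}$ ($i<n$), at least $k$ of $\sigma_{i+1},\dots,\sigma_m$ are greater than $\sigma_i$. $mmp^{(k\le\max,\emptyset,0,0)}(\sigma)$ is the number of such $i$, and $R_n^{(k\le\max,\emptyset,0,0)}(x)=\sum_{\sigma\in S_n}x^{mmp^{(k\le\max,\emptyset,0,0)}(\sigma)}$. -}

module Defs where

open import Data.Nat using (ℕ; zero; suc; _+_; _<ᵇ_; _≡ᵇ_; _≤ᵇ_; _⊔_)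
open import Data.Bool using (Bool; true; false; if_then_else_; _∧_; not)
open import Data.List using (List; []; _∷_; foldr)
open import Data.Bool.ListAction using (any)
open import Data.Vec using (Vec; toList)
import Data.Vec as V
open import Data.Fin using (Fin; toℕ)

-- A permutation σ ∈ S_n is encoded as the word σ₁⋯σₙ, i.e. a vector of
-- length n with entries in Fin n (values 0..n-1 instead of 1..n, which does
-- not affect any order-based statistic) whose entries are pairwise distinct.

distinct : List ℕ → Bool
distinct [] = true
distinct (x ∷ xs) = not (any (x ≡ᵇ_) xs) ∧ distinct xs

word : ∀ {n} → Vec (Fin n) n → List ℕ
word σ = toList (V.map toℕ σ)

isPerm : ∀ {n} → Vec (Fin n) n → Bool
isPerm σ = distinct (word σ)

countGT : ℕ → List ℕ → ℕ
countGT x [] = 0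
countGT x (y ∷ ys) = if x <ᵇ y then suc (countGT x ys) else countGT x ys

-- maximum of a list (0 for the empty list; only used on nonempty lists)
maxL : List ℕ → ℕ
maxL = foldr _⊔_ 0

uptoFirst : ℕ → List ℕ → List ℕ
uptoFirst M [] = []
uptoFirst M (y ∷ ys) = if y ≡ᵇ M then y ∷ [] else y ∷ uptoFirst M ys

-- given σᵢ = x and the suffix σ_{i+1} ⋯ σ_n : the suffix is nonempty (i < n)
-- and, with σ_m = max{σ_{i+1},…,σ_n}, at least k of σ_{i+1},…,σ_m exceed x
suffixCond : ℕ → ℕ → List ℕ → Bool
suffixCond k x [] = false
suffixCond k x (y ∷ ys) = k ≤ᵇ countGT x (uptoFirst (maxL (y ∷ ys)) (y ∷ ys))

-- mmpAux k pre xs : number of positions in xs matching MMP(k≤max,∅,0,0),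
-- where pre is the list of entries to the left of xs.
-- Left condition: no earlier σⱼ is greater than σᵢ.
mmpAux : ℕ → List ℕ → List ℕ → ℕ
mmpAux k pre [] = 0
mmpAux k pre (x ∷ xs) =
  (if (countGT x pre ≡ᵇ 0) ∧ suffixCond k x xs then 1 else 0) + mmpAux k (x ∷ pre) xs

mmp : ∀ {n} → ℕ → Vec (Fin n) n → ℕ
mmp k σ = mmpAux k [] (word σ)

-- Each occurrence of the pattern needs k larger entries to its right, so mmp σ ≤ n − k, and
-- equality forces each of the first n − k entries to be an occurrence. Occurrences are
-- left-to-right maxima, so these entries increase, and the last of them sees a suffix of exactly
-- k entries, all larger than it, whose maximum comes last. Counting the available values leaves
-- one shape: σ = 1 2 ⋯ (n−k), then any arrangement of n−k+1, …, n−1, then n. These σ correspond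
-- to the permutations of k − 1 letters, of which there are (k − 1)!.

module Submission where

open import Defs
open import Data.Nat using (ℕ; _+_; _∸_; _≤_; _!)
open import Data.Fin using (Fin)
open import Data.Vec using (Vec)
open import Data.Bool using (T)
open import Data.Product using (Σ-syntax; _×_)
open import Function.Bundles using (_↔_)
open import Relation.Binary.PropositionalEquality using (_≡_)

open import Data.Nat using (zero; suc; _<_; z≤n; s≤s; z<s; _<ᵇ_; _≡ᵇ_; _≤ᵇ_; _⊔_; _<?_)
open import Data.Nat.Properties
open import Data.Bool using (Bool; true; false; _∧_; not)
open import Data.Bool.Properties using (T-∧; T-≡; T-irrelevant)
open import Data.Bool.ListAction using (any)
open import Data.Unit using (tt)
open import Data.Empty using (⊥-elim)
open import Data.Product using (Σ; _,_; proj₁; proj₂)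
open import Data.Product.Properties using (Σ-≡,≡→≡)
open import Data.Sum using (inj₁; inj₂)
open import Data.List as List using (List; []; _∷_; _++_; _∷ʳ_; [_]; length; filter; lookup)
open import Data.List.Properties as List
  using (length-++; ++-assoc; length-filter; filter-all; filter-complete; filter-some; filter-none)
open import Data.List.Relation.Unary.All as All using (All; []; _∷_)
open import Data.List.Relation.Unary.All.Properties as All using (all-filter; ¬Any⇒All¬)
open import Data.List.Relation.Unary.Any using (here; there)
open import Data.List.Relation.Unary.AllPairs as AllPairs using (AllPairs; []; _∷_)
import Data.List.Relation.Unary.AllPairs.Properties as AllPairs
open import Data.List.Relation.Unary.Unique.Propositional using (Unique)
import Data.List.Relation.Unary.Unique.Propositional.Properties as Unique
open import Data.List.Membership.Propositional using (_∈_)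
open import Data.List.Membership.Propositional.Properties using (∈-++⁻; ∈-lookup)
open import Data.Fin as Fin using (toℕ; fromℕ<; _↑ʳ_; _↑ˡ_)
open import Data.Fin.Properties
  using ( toℕ-fromℕ<; injective⇒≤; toℕ-injective; toℕ<n; punchIn-injective; punchInᵢ≢i; punchIn-punchOut; *↔×
        ; toℕ-↑ʳ; toℕ-↑ˡ; toℕ-inject₁; toℕ-fromℕ; inject₁-injective; ↑ʳ-injective)
open import Data.Vec as Vec using ([]; _∷_)
import Data.Vec.Properties as Vec
open import Data.Product.Function.NonDependent.Propositional using (_×-↔_)
open import Function.Bundles using (Equivalence; mk↔ₛ′)
open import Function.Construct.Composition using (_↔-∘_)
open import Function.Construct.Symmetry using (↔-sym)
open import Function.Properties.Inverse using (↔-refl)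
open import Function.Related.TypeIsomorphisms using (Σ-assoc)
open import Relation.Binary.PropositionalEquality
  using (_≢_; refl; sym; trans; cong; cong₂; subst; module ≡-Reasoning)
open import Relation.Nullary using (¬_; Irrelevant)
open import Function using (_∘_)

Σ↔Σ-by-injection : ∀ {A B : Set} {Q : A → Set} {P : B → Set} (f : A → B) →
  (∀ {a a′} → f a ≡ f a′ → a ≡ a′) → (∀ {a} → Irrelevant (Q a)) → (∀ {b} → Irrelevant (P b)) →
  (∀ {a} → Q a → P (f a)) → (∀ {b} → P b → Σ[ a ∈ A ] Q a × f a ≡ b) → Σ A Q ↔ Σ B P
Σ↔Σ-by-injection {A} {B} {Q} {P} f f-injective Q-irrelevant P-irrelevant preserves reflects =
  mk↔ₛ′ to from to∘from from∘to
  where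
  to : Σ A Q → Σ B P
  to (a , q) = f a , preserves q
  from : Σ B P → Σ A Q
  from (b , p) = proj₁ (reflects p) , proj₁ (proj₂ (reflects p))
  to∘from : ∀ bp → to (from bp) ≡ bp
  to∘from (b , p) = Σ-≡,≡→≡ (proj₂ (proj₂ (reflects p)) , P-irrelevant _ _)
  from∘to : ∀ aq → from (to aq) ≡ aq
  from∘to (a , q) = Σ-≡,≡→≡ (f-injective (proj₂ (proj₂ (reflects (preserves q)))) , Q-irrelevant _ _)

module _ {a r} {A : Set a} {R : A → A → Set r} where

  AllPairs-++⁻ : ∀ xs {ys} → AllPairs R (xs ++ ys) →
    AllPairs R xs × AllPairs R ys × All (λ x → All (R x) ys) xs
  AllPairs-++⁻ []       Rys          = [] , Rys , []
  AllPairs-++⁻ (x ∷ xs) (Rx ∷ Rxsys) =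
    let Rxs , Rys , Rxsys′ = AllPairs-++⁻ xs Rxsys
    in All.++⁻ˡ xs Rx ∷ Rxs , Rys , All.++⁻ʳ xs Rx ∷ Rxsys′

Unique-lookup-injective : ∀ {xs : List ℕ} → Unique xs →
  ∀ {i j} → lookup xs i ≡ lookup xs j → i ≡ j
Unique-lookup-injective (_ ∷ _)   {Fin.zero}  {Fin.zero}  _ = refl
Unique-lookup-injective (x∉ ∷ _)  {Fin.zero}  {Fin.suc j} e = ⊥-elim (All.lookup x∉ (∈-lookup j) e)
Unique-lookup-injective (x∉ ∷ _)  {Fin.suc i} {Fin.zero}  e = ⊥-elim (All.lookup x∉ (∈-lookup i) (sym e))
Unique-lookup-injective (_ ∷ xs!) {Fin.suc i} {Fin.suc j} e = cong Fin.suc (Unique-lookup-injective xs! e)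

Unique-in-range⇒length≤ : ∀ {a b} {ys : List ℕ} → Unique ys → a ≤ b →
  All (λ y → a ≤ y × y < b) ys → a + length ys ≤ b
Unique-in-range⇒length≤ {a} {b} {ys} ys! a≤b inRange =
  subst (_≤ b) (+-comm (length ys) a) (m≤o∸n⇒m+n≤o (length ys) a≤b (injective⇒≤ shift-injective))
  where
  bounds : ∀ i → a ≤ lookup ys i × lookup ys i < b
  bounds i = All.lookup inRange (∈-lookup i)

  shift : Fin (length ys) → Fin (b ∸ a)
  shift i = fromℕ< (∸-monoˡ-< (proj₂ (bounds i)) (proj₁ (bounds i)))

  shift-injective : ∀ {i j} → shift i ≡ shift j → i ≡ j
  shift-injective {i} {j} e = Unique-lookup-injective ys! (∸-cancelʳ-≡ (proj₁ (bounds i)) (proj₁ (bounds j))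
    (trans (sym (toℕ-fromℕ< _)) (trans (cong toℕ e) (toℕ-fromℕ< _))))

interval : ℕ → ℕ → List ℕ
interval a zero    = []
interval a (suc c) = a ∷ interval (suc a) c

interval-bounds : ∀ a c → All (λ y → a ≤ y × y < a + c) (interval a c)
interval-bounds a zero    = []
interval-bounds a (suc c) = (≤-refl , m<m+n a z<s) ∷
  All.map (λ {y} (a<y , y<) → <⇒≤ a<y , subst (y <_) (sym (+-suc a c)) y<) (interval-bounds (suc a) c)

interval-increasing : ∀ a c → AllPairs _<_ (interval a c)
interval-increasing a zero    = []
interval-increasing a (suc c) =
  All.map proj₁ (interval-bounds (suc a) c) ∷ interval-increasing (suc a) c

increasing-bounded⇒interval : ∀ a xs → AllPairs _<_ xs →
  All (a ≤_) xs → All (_< a + length xs) xs → xs ≡ interval a (length xs)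
increasing-bounded⇒interval a []       _               _         _            = refl
increasing-bounded⇒interval a (x ∷ xs) (x<xs ∷ xs-inc) (a≤x ∷ _) (x<b ∷ xs<b) =
  cong₂ _∷_ (≤-antisym x≤a a≤x) (increasing-bounded⇒interval (suc a) xs xs-inc
    (All.map (≤-<-trans a≤x) x<xs) (subst (λ b → All (_< b) xs) (+-suc a (length xs)) xs<b))
  where
  -- the length xs entries above x must fit below a + suc (length xs)
  x≤a : x ≤ a
  x≤a = ≤-pred (+-cancelʳ-≤ (length xs) (suc x) (suc a)
    (subst (suc x + length xs ≤_) (+-suc a (length xs))
      (Unique-in-range⇒length≤ (AllPairs.map <⇒≢ xs-inc) x<b (All.zip (x<xs , xs<b)))))

-- The suffix condition

not-any≡ᵇ⇒All≢ : ∀ {x} ys → T (not (any (x ≡ᵇ_) ys)) → All (x ≢_) ys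
not-any≡ᵇ⇒All≢         []       _ = []
not-any≡ᵇ⇒All≢ {x} (y ∷ ys) p with x ≡ᵇ y in eq
... | false = (λ x≡y → subst T eq (≡⇒≡ᵇ x y x≡y)) ∷ not-any≡ᵇ⇒All≢ ys p

All≢⇒not-any≡ᵇ : ∀ {x} ys → All (x ≢_) ys → T (not (any (x ≡ᵇ_) ys))
All≢⇒not-any≡ᵇ         []       []           = tt
All≢⇒not-any≡ᵇ {x} (y ∷ ys) (x≢y ∷ x∉ys) with x ≡ᵇ y in eq
... | true  = x≢y (≡ᵇ⇒≡ x y (subst T (sym eq) tt))
... | false = All≢⇒not-any≡ᵇ ys x∉ys

distinct⇒Unique : ∀ xs → T (distinct xs) → Unique xs
distinct⇒Unique []       _ = []
distinct⇒Unique (x ∷ xs) p =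
  let x∉xs , xs! = Equivalence.to T-∧ p in not-any≡ᵇ⇒All≢ xs x∉xs ∷ distinct⇒Unique xs xs!

Unique⇒distinct : ∀ {xs} → Unique xs → T (distinct xs)
Unique⇒distinct []            = tt
Unique⇒distinct (x∉xs ∷ xs!) = Equivalence.from T-∧ (All≢⇒not-any≡ᵇ _ x∉xs , Unique⇒distinct xs!)

countGT≡length-filter : ∀ x ys → countGT x ys ≡ length (filter (x <?_) ys)
countGT≡length-filter x []       = refl
countGT≡length-filter x (y ∷ ys) with x <ᵇ y
... | true  = cong suc (countGT≡length-filter x ys)
... | false = countGT≡length-filter x ys

countGT≤length : ∀ x ys → countGT x ys ≤ length ys
countGT≤length x ys = subst (_≤ length ys) (sym (countGT≡length-filter x ys)) (length-filter (x <?_) ys)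

countGT≡length⇒All> : ∀ x ys → countGT x ys ≡ length ys → All (x <_) ys
countGT≡length⇒All> x ys e = subst (All (x <_))
  (filter-complete (x <?_) (trans (sym (countGT≡length-filter x ys)) e)) (all-filter (x <?_) ys)

All>⇒countGT≡length : ∀ {x ys} → All (x <_) ys → countGT x ys ≡ length ys
All>⇒countGT≡length {x} {ys} x<ys = trans (countGT≡length-filter x ys) (cong length (filter-all (x <?_) x<ys))

countGT≡0⇒All≤ : ∀ x ys → countGT x ys ≡ 0 → All (_≤ x) ys
countGT≡0⇒All≤ x ys e = All.map ≮⇒≥ (¬Any⇒All¬ ys λ some> →
  <⇒≢ (filter-some (x <?_) some>) (sym (trans (sym (countGT≡length-filter x ys)) e)))

All≤⇒countGT≡0 : ∀ {x ys} → All (_≤ x) ys → countGT x ys ≡ 0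
All≤⇒countGT≡0 {x} {ys} ys≤x =
  trans (countGT≡length-filter x ys) (cong length (filter-none (x <?_) (All.map ≤⇒≯ ys≤x)))

countGT-uptoFirst≤ : ∀ x M ys → countGT x (uptoFirst M ys) ≤ countGT x ys
countGT-uptoFirst≤ x M []       = z≤n
countGT-uptoFirst≤ x M (y ∷ ys) with y ≡ᵇ M
... | true  with x <ᵇ y
...   | true  = s≤s z≤n
...   | false = z≤n
countGT-uptoFirst≤ x M (y ∷ ys) | false with x <ᵇ y
...   | true  = s≤s (countGT-uptoFirst≤ x M ys)
...   | false = countGT-uptoFirst≤ x M ys

uptoFirst-∷ʳ : ∀ M u t → All (_≢ M) u → uptoFirst M (u ∷ʳ t) ≡ u ∷ʳ t
uptoFirst-∷ʳ M []      t [] with t ≡ᵇ M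
... | true  = refl
... | false = refl
uptoFirst-∷ʳ M (y ∷ u) t (y≢M ∷ u≢M) with y ≡ᵇ M in eq
... | true  = ⊥-elim (y≢M (≡ᵇ⇒≡ y M (Equivalence.from T-≡ eq)))
... | false = cong (y ∷_) (uptoFirst-∷ʳ M u t u≢M)

uptoFirst-∷ʳ⁻ : ∀ M u t → length (u ∷ʳ t) ≤ length (uptoFirst M (u ∷ʳ t)) → All (_≢ M) u
uptoFirst-∷ʳ⁻ M []      t _   = []
uptoFirst-∷ʳ⁻ M (y ∷ u) t len with y ≡ᵇ M in eq
... | true  = ⊥-elim (∷ʳ-nonempty u (≤-pred len))
  where
  ∷ʳ-nonempty : ∀ u → ¬ length (u ∷ʳ t) ≤ 0
  ∷ʳ-nonempty []      ()
  ∷ʳ-nonempty (_ ∷ _) ()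
... | false = (λ y≡M → subst T eq (≡⇒≡ᵇ y M y≡M)) ∷ uptoFirst-∷ʳ⁻ M u t (≤-pred len)

maxL-upper : ∀ ys → All (_≤ maxL ys) ys
maxL-upper []       = []
maxL-upper (y ∷ ys) =
  m≤m⊔n y (maxL ys) ∷ All.map (λ y′≤ → ≤-trans y′≤ (m≤n⊔m y (maxL ys))) (maxL-upper ys)

maxL-∷ʳ-∈ : ∀ u t → maxL (u ∷ʳ t) ∈ u ∷ʳ t
maxL-∷ʳ-∈ []      t = here (⊔-identityʳ t)
maxL-∷ʳ-∈ (y ∷ u) t with ⊔-sel y (maxL (u ∷ʳ t))
... | inj₁ e = here e
... | inj₂ e = there (subst (_∈ u ∷ʳ t) (sym e) (maxL-∷ʳ-∈ u t))

maxL-∷ʳ : ∀ u t → All (_≤ t) u → maxL (u ∷ʳ t) ≡ t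
maxL-∷ʳ []      t []          = ⊔-identityʳ t
maxL-∷ʳ (y ∷ u) t (y≤t ∷ u≤t) = trans (cong (y ⊔_) (maxL-∷ʳ u t u≤t)) (m≤n⇒m⊔n≡n y≤t)

maxL-∉-init⇒last-max : ∀ u t → All (_≢ maxL (u ∷ʳ t)) u → All (_< t) u
maxL-∉-init⇒last-max u t u≢M with ∈-++⁻ u (maxL-∷ʳ-∈ u t)
... | inj₁ M∈u        = ⊥-elim (All.lookup u≢M M∈u refl)
... | inj₂ (here M≡t) = subst (λ M → All (_< M) u) M≡t
  (All.zipWith (λ (y≤M , y≢M) → ≤∧≢⇒< y≤M y≢M) (All.++⁻ˡ u (maxL-upper (u ∷ʳ t)) , u≢M))

suffixCond-∷ʳ : ∀ k x u t →
  suffixCond k x (u ∷ʳ t) ≡ (k ≤ᵇ countGT x (uptoFirst (maxL (u ∷ʳ t)) (u ∷ʳ t)))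
suffixCond-∷ʳ k x []      t = refl
suffixCond-∷ʳ k x (_ ∷ _) t = refl

suffixCond⇒k≤length : ∀ k x ys → T (suffixCond k x ys) → k ≤ length ys
suffixCond⇒k≤length k x (y ∷ ys) p = begin
  k                                                 ≤⟨ ≤ᵇ⇒≤ k _ p ⟩
  countGT x (uptoFirst (maxL (y ∷ ys)) (y ∷ ys))    ≤⟨ countGT-uptoFirst≤ x (maxL (y ∷ ys)) (y ∷ ys) ⟩
  countGT x (y ∷ ys)                                ≤⟨ countGT≤length x (y ∷ ys) ⟩
  length (y ∷ ys)                                   ∎
  where open ≤-Reasoning

suffixCond-lastMax⁺ : ∀ {k x} u t → k ≤ length (u ∷ʳ t) →
  All (x <_) (u ∷ʳ t) → All (_< t) u → T (suffixCond k x (u ∷ʳ t))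
suffixCond-lastMax⁺ {k} {x} u t k≤len x<ys u<t =
  subst T (sym (suffixCond-∷ʳ k x u t)) (≤⇒≤ᵇ (subst (k ≤_) (sym count≡len) k≤len))
  where
  open ≡-Reasoning
  count≡len : countGT x (uptoFirst (maxL (u ∷ʳ t)) (u ∷ʳ t)) ≡ length (u ∷ʳ t)
  count≡len = begin
    countGT x (uptoFirst (maxL (u ∷ʳ t)) (u ∷ʳ t)) ≡⟨ cong (λ M → countGT x (uptoFirst M (u ∷ʳ t)))
                                                         (maxL-∷ʳ u t (All.map <⇒≤ u<t)) ⟩
    countGT x (uptoFirst t (u ∷ʳ t))               ≡⟨ cong (countGT x) (uptoFirst-∷ʳ t u t (All.map <⇒≢ u<t)) ⟩
    countGT x (u ∷ʳ t)                             ≡⟨ All>⇒countGT≡length x<ys ⟩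
    length (u ∷ʳ t)                                ∎

-- When the suffix has only k entries, all of them must be counted, so none is cut off.
suffixCond-lastMax⁻ : ∀ {k x} u t → length (u ∷ʳ t) ≤ k →
  T (suffixCond k x (u ∷ʳ t)) → All (x <_) (u ∷ʳ t) × All (_< t) u
suffixCond-lastMax⁻ {k} {x} u t len≤k p =
  countGT≡length⇒All> x ys count≡len , maxL-∉-init⇒last-max u t (uptoFirst-∷ʳ⁻ M u t len≤prefix)
  where
  ys = u ∷ʳ t
  M = maxL ys
  k≤count : k ≤ countGT x (uptoFirst M ys)
  k≤count = ≤ᵇ⇒≤ k _ (subst T (suffixCond-∷ʳ k x u t) p)
  count≡len : countGT x ys ≡ length ys
  count≡len = ≤-antisym (countGT≤length x ys)
    (≤-trans len≤k (≤-trans k≤count (countGT-uptoFirst≤ x M ys)))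
  len≤prefix : length ys ≤ length (uptoFirst M ys)
  len≤prefix = ≤-trans len≤k (≤-trans k≤count (countGT≤length x (uptoFirst M ys)))

isMatch : ℕ → List ℕ → ℕ → List ℕ → Bool
isMatch k pre x xs = (countGT x pre ≡ᵇ 0) ∧ suffixCond k x xs

isMatch⁺ : ∀ {k pre x xs} → All (_≤ x) pre → T (suffixCond k x xs) → T (isMatch k pre x xs)
isMatch⁺ pre≤x sc = Equivalence.from T-∧ (≡⇒≡ᵇ _ 0 (All≤⇒countGT≡0 pre≤x) , sc)

isMatch⁻ : ∀ {k pre x xs} → T (isMatch k pre x xs) → All (_≤ x) pre × T (suffixCond k x xs)
isMatch⁻ {pre = pre} {x} p =
  let count≡0 , sc = Equivalence.to T-∧ p in countGT≡0⇒All≤ x pre (≡ᵇ⇒≡ _ 0 count≡0) , sc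

mmpAux-match : ∀ {k pre x w} → T (isMatch k pre x w) → mmpAux k pre (x ∷ w) ≡ suc (mmpAux k (x ∷ pre) w)
mmpAux-match {k} {pre} {x} {w} p with (countGT x pre ≡ᵇ 0) ∧ suffixCond k x w
... | true = refl

mmpAux≤length∸k : ∀ k pre w → mmpAux k pre w ≤ length w ∸ k
mmpAux≤length∸k k pre []      = z≤n
mmpAux≤length∸k k pre (x ∷ w) with (countGT x pre ≡ᵇ 0) ∧ suffixCond k x w in eq
... | true  = begin
  suc (mmpAux k (x ∷ pre) w) ≤⟨ s≤s (mmpAux≤length∸k k (x ∷ pre) w) ⟩
  suc (length w ∸ k)         ≡⟨ sym (+-∸-assoc 1 k≤w) ⟩
  suc (length w) ∸ k         ∎
  where
  open ≤-Reasoning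
  k≤w = suffixCond⇒k≤length k x w (proj₂ (isMatch⁻ {k} {pre} {x} {w} (Equivalence.from T-≡ eq)))
... | false = ≤-trans (mmpAux≤length∸k k (x ∷ pre) w) (∸-monoˡ-≤ k (n≤1+n (length w)))

mmpAux-saturated : ∀ {k pre x w} → k ≤ length w → mmpAux k pre (x ∷ w) ≡ length (x ∷ w) ∸ k →
  (All (_≤ x) pre × T (suffixCond k x w)) × mmpAux k (x ∷ pre) w ≡ length w ∸ k
mmpAux-saturated {k} {pre} {x} {w} k≤w e with (countGT x pre ≡ᵇ 0) ∧ suffixCond k x w in eq
... | true  =
  isMatch⁻ {k} {pre} {x} {w} (Equivalence.from T-≡ eq) , suc-injective (trans e (+-∸-assoc 1 k≤w))
... | false = ⊥-elim (<⇒≱ (s≤s ≤-refl)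
  (subst (_≤ length w ∸ k) (trans e (+-∸-assoc 1 k≤w)) (mmpAux≤length∸k k (x ∷ pre) w)))

-- The shape of a word pre ++ xs ++ u ∷ʳ t in which mmpAux counts every entry of xs.
record Extremal (pre xs u : List ℕ) (t : ℕ) : Set where
  field
    leftMaxima  : All (λ x → All (_≤ x) pre) xs
    increasing  : AllPairs _<_ xs
    belowSuffix : All (λ x → All (x <_) (u ∷ʳ t)) xs
    lastMaximal : All (_< t) u

Extremal-tail : ∀ {pre x xs u t} → Extremal pre (x ∷ xs) u t → Extremal (x ∷ pre) xs u t
Extremal-tail ext = record
  { leftMaxima  = All.zipWith (λ (x<y , pre≤y) → <⇒≤ x<y ∷ pre≤y)
                    (AllPairs.head increasing , All.tail leftMaxima)
  ; increasing  = AllPairs.tail increasing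
  ; belowSuffix = All.tail belowSuffix
  ; lastMaximal = lastMaximal
  }
  where open Extremal ext

Extremal⇒length≤mmpAux : ∀ {k pre xs u t} → Extremal pre xs u t → k ≤ length (u ∷ʳ t) →
  length xs ≤ mmpAux k pre (xs ++ u ∷ʳ t)
Extremal⇒length≤mmpAux {xs = []} _ _ = z≤n
Extremal⇒length≤mmpAux {k} {pre} {x ∷ xs} {u} {t} ext k≤ys =
  subst (suc (length xs) ≤_) (sym (mmpAux-match {k} {pre} {x} {xs ++ u ∷ʳ t} match))
    (s≤s (Extremal⇒length≤mmpAux {k} (Extremal-tail ext) k≤ys))
  where
  open Extremal ext
  x<rest : All (x <_) (xs ++ u ∷ʳ t)
  x<rest = All.++⁺ (AllPairs.head increasing) (All.head belowSuffix)
  rest<t : All (_< t) (xs ++ u)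
  rest<t = All.++⁺ (All.map (λ y<ys → All.head (All.++⁻ʳ u y<ys)) (All.tail belowSuffix)) lastMaximal
  k≤rest : k ≤ length (xs ++ u ∷ʳ t)
  k≤rest = ≤-trans k≤ys (List.length-++-≤ʳ (u ∷ʳ t) {xs})
  match : T (isMatch k pre x (xs ++ u ∷ʳ t))
  match = isMatch⁺ {k} {pre} {x} {xs ++ u ∷ʳ t} (All.head leftMaxima)
    (subst (T ∘ suffixCond k x) (++-assoc xs u [ t ]) (suffixCond-lastMax⁺ {k} {x} (xs ++ u) t
      (subst (λ ys → k ≤ length ys) (sym (++-assoc xs u [ t ])) k≤rest)
      (subst (All (x <_)) (sym (++-assoc xs u [ t ])) x<rest)
      rest<t))

saturated⇒Extremal : ∀ {k pre x xs u t} → Unique (x ∷ xs) → length (u ∷ʳ t) ≡ k →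
  mmpAux k pre (x ∷ xs ++ u ∷ʳ t) ≡ length (x ∷ xs ++ u ∷ʳ t) ∸ k → Extremal pre (x ∷ xs) u t
saturated⇒Extremal {k} {pre} {x} {xs} {u} {t} (x∉xs ∷ xs!) len≡k saturated =
  extend xs x∉xs xs! (mmpAux-saturated {k} {pre} {x} {xs ++ u ∷ʳ t} k≤rest saturated)
  where
  k≤rest : k ≤ length (xs ++ u ∷ʳ t)
  k≤rest = subst (_≤ length (xs ++ u ∷ʳ t)) len≡k (List.length-++-≤ʳ (u ∷ʳ t) {xs})
  extend : ∀ ys → All (x ≢_) ys → Unique ys →
    (All (_≤ x) pre × T (suffixCond k x (ys ++ u ∷ʳ t))) ×
      mmpAux k (x ∷ pre) (ys ++ u ∷ʳ t) ≡ length (ys ++ u ∷ʳ t) ∸ k →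
    Extremal pre (x ∷ ys) u t
  extend [] _ _ ((pre≤x , sc) , _) =
    let x<ys , u<t = suffixCond-lastMax⁻ {k} {x} u t (≤-reflexive len≡k) sc in record
    { leftMaxima  = pre≤x ∷ []
    ; increasing  = [] ∷ []
    ; belowSuffix = x<ys ∷ []
    ; lastMaximal = u<t
    }
  extend (y ∷ ys) x∉ys ys! ((pre≤x , _) , rest-saturated) = record
    { leftMaxima  = pre≤x ∷ All.map All.tail leftMaxima
    ; increasing  = x<ys ∷ increasing
    ; belowSuffix = All.map (<-trans (All.head x<ys)) (All.head belowSuffix) ∷ belowSuffix
    ; lastMaximal = lastMaximal
    }
    where
    open Extremal (saturated⇒Extremal {k} {x ∷ pre} {y} {ys} {u} {t} ys! len≡k rest-saturated)
    x<ys : All (x <_) (y ∷ ys)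
    x<ys = All.zipWith (λ (x≤z , x≢z) → ≤∧≢⇒< x≤z x≢z) (All.map All.head leftMaxima , x∉ys)

-- Words of maximal statistic

length-∷ʳ : ∀ (u : List ℕ) t → length (u ∷ʳ t) ≡ suc (length u)
length-∷ʳ u t = trans (length-++ u) (+-comm (length u) 1)

length-interval : ∀ a c → length (interval a c) ≡ c
length-interval a zero    = refl
length-interval a (suc c) = cong suc (length-interval (suc a) c)

-- Pigeonhole pins down the values: above each entry of xs there must be room for the suc m
-- larger entries of u ∷ʳ t, and below each entry of u ∷ʳ t for the c entries of xs.
Extremal-values : ∀ {pre xs u t c m} → length xs ≡ c → length u ≡ m →
  Unique (xs ++ u ∷ʳ t) → All (_< c + suc m) (xs ++ u ∷ʳ t) → Extremal pre xs u t →
  xs ≡ interval 0 c × t ≡ c + m × All (λ y → c ≤ y × y < c + m) u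
Extremal-values {xs = xs} {u} {t} refl refl unique bounded ext =
  xs≡interval , t≡c+m , All.zip (All.++⁻ˡ u c≤ys , subst (λ b → All (_< b) u) t≡c+m lastMaximal)
  where
  open Extremal ext
  c = length xs
  m = length u
  ys = u ∷ʳ t
  xs! = proj₁ (AllPairs-++⁻ xs unique)
  ys! = proj₁ (proj₂ (AllPairs-++⁻ xs unique))
  u! = proj₁ (AllPairs-++⁻ u ys!)

  xs<c : All (_< c) xs
  xs<c = All.zipWith (λ {x} (x<ys , x<n) → +-cancelʳ-≤ (suc m) (suc x) c
      (subst (λ l → suc x + l ≤ c + suc m) (length-∷ʳ u t)
        (Unique-in-range⇒length≤ ys! x<n (All.zip (x<ys , All.++⁻ʳ xs bounded)))))
    (belowSuffix , All.++⁻ˡ xs bounded)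

  xs≡interval : xs ≡ interval 0 c
  xs≡interval = increasing-bounded⇒interval 0 xs increasing (All.tabulate (λ _ → z≤n)) xs<c

  c≤ys : All (c ≤_) ys
  c≤ys = All.tabulate λ y∈ys → Unique-in-range⇒length≤ xs! z≤n
    (All.map (λ x<ys → z≤n , All.lookup x<ys y∈ys) belowSuffix)

  t≡c+m : t ≡ c + m
  t≡c+m = ≤-antisym (≤-pred (subst (t <_) (+-suc c m) (All.head (All.++⁻ʳ u (All.++⁻ʳ xs bounded)))))
    (Unique-in-range⇒length≤ u! (All.head (All.++⁻ʳ u c≤ys)) (All.zip (All.++⁻ˡ u c≤ys , lastMaximal)))

canonical : ℕ → ℕ → List ℕ → List ℕ
canonical c m vs = interval 0 c ++ List.map (c +_) vs ∷ʳ (c + m)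

canonical-Extremal : ∀ c m {vs} → All (_< m) vs →
  Extremal [] (interval 0 c) (List.map (c +_) vs) (c + m)
canonical-Extremal c m {vs} vs<m = record
  { leftMaxima  = All.tabulate (λ _ → [])
  ; increasing  = interval-increasing 0 c
  ; belowSuffix = All.map (λ (_ , x<c) → All.map (<-≤-trans x<c) c≤suffix) (interval-bounds 0 c)
  ; lastMaximal = lifted<top
  }
  where
  lifted<top : All (_< c + m) (List.map (c +_) vs)
  lifted<top = All.map⁺ (All.map (+-monoʳ-< c) vs<m)
  c≤suffix : All (c ≤_) (List.map (c +_) vs ∷ʳ (c + m))
  c≤suffix = All.++⁺ (All.map⁺ (All.tabulate (λ _ → m≤m+n c _))) (m≤m+n c m ∷ [])

canonical-Unique : ∀ c m {vs} → Unique vs → All (_< m) vs → Unique (canonical c m vs)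
canonical-Unique c m vs! vs<m = AllPairs.++⁺ (AllPairs.map <⇒≢ increasing)
  (AllPairs.++⁺ (Unique.map⁺ (+-cancelˡ-≡ c _ _) vs!) ([] ∷ [])
    (All.map (λ v<top → <⇒≢ v<top ∷ []) lastMaximal))
  (All.map (All.map <⇒≢) belowSuffix)
  where open Extremal (canonical-Extremal c m vs<m)

canonical-Unique⁻ : ∀ c m vs → Unique (canonical c m vs) → Unique vs
canonical-Unique⁻ c m vs unique = Unique.map⁻ (proj₁ (AllPairs-++⁻ (List.map (c +_) vs)
  (proj₁ (proj₂ (AllPairs-++⁻ (interval 0 c) unique)))))

canonical-mmp : ∀ c m {vs} → length vs ≡ m → All (_< m) vs → mmpAux (suc m) [] (canonical c m vs) ≡ c
canonical-mmp c m {vs} refl vs<m = ≤-antisym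
  (≤-trans (mmpAux≤length∸k (suc m) [] (canonical c m vs)) (≤-reflexive length∸k≡c))
  (subst (_≤ mmpAux (suc m) [] (canonical c m vs)) (length-interval 0 c)
    (Extremal⇒length≤mmpAux (canonical-Extremal c m vs<m) (≤-reflexive (sym suffix-length))))
  where
  open ≡-Reasoning
  suffix-length : length (List.map (c +_) vs ∷ʳ (c + m)) ≡ suc m
  suffix-length = trans (length-∷ʳ (List.map (c +_) vs) (c + m)) (cong suc (List.length-map (c +_) vs))
  length∸k≡c : length (canonical c m vs) ∸ suc m ≡ c
  length∸k≡c = begin
    length (canonical c m vs) ∸ suc m
      ≡⟨ cong (_∸ suc m) (length-++ (interval 0 c)) ⟩
    length (interval 0 c) + length (List.map (c +_) vs ∷ʳ (c + m)) ∸ suc m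
      ≡⟨ cong₂ (λ a b → a + b ∸ suc m) (length-interval 0 c) suffix-length ⟩
    c + suc m ∸ suc m
      ≡⟨ m+n∸n≡m c (suc m) ⟩
    c ∎

-- Permutations as vectors

Vec-map-injective : ∀ {A B : Set} {f : A → B} → (∀ {x y} → f x ≡ f y → x ≡ y) →
  ∀ {l} {u v : Vec A l} → Vec.map f u ≡ Vec.map f v → u ≡ v
Vec-map-injective f-injective {u = []}    {[]}    _ = refl
Vec-map-injective f-injective {u = x ∷ u} {y ∷ v} e =
  cong₂ _∷_ (f-injective (Vec.∷-injectiveˡ e)) (Vec-map-injective f-injective (Vec.∷-injectiveʳ e))

toℕs : ∀ {n l} → Vec (Fin n) l → List ℕ
toℕs v = Vec.toList (Vec.map toℕ v)

toℕs-++ : ∀ {n a b} (u : Vec (Fin n) a) (v : Vec (Fin n) b) → toℕs (u Vec.++ v) ≡ toℕs u ++ toℕs v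
toℕs-++ u v = trans (cong Vec.toList (Vec.map-++ toℕ u v)) (Vec.toList-++ (Vec.map toℕ u) (Vec.map toℕ v))

toℕs-∷ʳ : ∀ {n l} (v : Vec (Fin n) l) x → toℕs (v Vec.∷ʳ x) ≡ toℕs v ∷ʳ toℕ x
toℕs-∷ʳ v x = trans (cong Vec.toList (Vec.map-∷ʳ toℕ x v)) (Vec.toList-∷ʳ (toℕ x) (Vec.map toℕ v))

length-toℕs : ∀ {n l} (v : Vec (Fin n) l) → length (toℕs v) ≡ l
length-toℕs v = Vec.length-toList (Vec.map toℕ v)

toℕs<n : ∀ {n l} (v : Vec (Fin n) l) → All (_< n) (toℕs v)
toℕs<n []      = []
toℕs<n (x ∷ v) = toℕ<n x ∷ toℕs<n v

toℕs-injective : ∀ {n l} {u v : Vec (Fin n) l} → toℕs u ≡ toℕs v → u ≡ v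
toℕs-injective {u = []}    {[]}    _ = refl
toℕs-injective {u = x ∷ u} {y ∷ v} e =
  cong₂ _∷_ (toℕ-injective (List.∷-injectiveˡ e)) (toℕs-injective (List.∷-injectiveʳ e))

toℕs-map : ∀ {a b l} (f : Fin a → Fin b) (g : ℕ → ℕ) → (∀ i → toℕ (f i) ≡ g (toℕ i)) →
  (v : Vec (Fin a) l) → toℕs (Vec.map f v) ≡ List.map g (toℕs v)
toℕs-map f g f≗g []      = refl
toℕs-map f g f≗g (x ∷ v) = cong₂ _∷_ (f≗g x) (toℕs-map f g f≗g v)

toℕs-tabulate : ∀ {n} a c (f : Fin c → Fin n) → (∀ i → toℕ (f i) ≡ a + toℕ i) →
  toℕs (Vec.tabulate f) ≡ interval a c
toℕs-tabulate a zero    f f≗a+ = refl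
toℕs-tabulate a (suc c) f f≗a+ = cong₂ _∷_ (trans (f≗a+ Fin.zero) (+-identityʳ a))
  (toℕs-tabulate (suc a) c (f ∘ Fin.suc) (λ i → trans (f≗a+ (Fin.suc i)) (+-suc a (toℕ i))))

distinct⇒Unique-toList : ∀ {n l} (v : Vec (Fin n) l) → T (distinct (toℕs v)) → Unique (Vec.toList v)
distinct⇒Unique-toList v p =
  Unique.map⁻ (subst Unique (Vec.toList-map toℕ v) (distinct⇒Unique (toℕs v) p))

Unique-toList⇒distinct : ∀ {n l} (v : Vec (Fin n) l) → Unique (Vec.toList v) → T (distinct (toℕs v))
Unique-toList⇒distinct v v! =
  Unique⇒distinct (subst Unique (sym (Vec.toList-map toℕ v)) (Unique.map⁺ toℕ-injective v!))

Perm : ℕ → Set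
Perm m = Σ[ σ ∈ Vec (Fin m) m ] T (isPerm σ)

insertHead : ∀ {m} → Fin (suc m) × Vec (Fin m) m → Vec (Fin (suc m)) (suc m)
insertHead (h , ρ) = h ∷ Vec.map (Fin.punchIn h) ρ

punchOutAll : ∀ {m l} (h : Fin (suc m)) (t : Vec (Fin (suc m)) l) → All (h ≢_) (Vec.toList t) →
  Vec (Fin m) l
punchOutAll h []      []          = []
punchOutAll h (x ∷ t) (h≢x ∷ h∉t) = Fin.punchOut h≢x ∷ punchOutAll h t h∉t

punchIn-punchOutAll : ∀ {m l} (h : Fin (suc m)) (t : Vec (Fin (suc m)) l)
  (h∉t : All (h ≢_) (Vec.toList t)) → Vec.map (Fin.punchIn h) (punchOutAll h t h∉t) ≡ t
punchIn-punchOutAll h []      []          = refl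
punchIn-punchOutAll h (x ∷ t) (h≢x ∷ h∉t) = cong₂ _∷_ (punchIn-punchOut h≢x) (punchIn-punchOutAll h t h∉t)

insertHead-injective : ∀ {m} {hρ hρ′ : Fin (suc m) × Vec (Fin m) m} →
  insertHead hρ ≡ insertHead hρ′ → hρ ≡ hρ′
insertHead-injective {hρ = h , ρ} {h′ , ρ′} e with Vec.∷-injective e
... | refl , ρ≡ρ′ = cong (h ,_) (Vec-map-injective (punchIn-injective h _ _) ρ≡ρ′)

insertHead-isPerm : ∀ {m} {hρ : Fin (suc m) × Vec (Fin m) m} →
  T (isPerm (proj₂ hρ)) → T (isPerm (insertHead hρ))
insertHead-isPerm {hρ = h , ρ} ρ-perm = Unique-toList⇒distinct (insertHead (h , ρ))
  (subst (All (h ≢_)) (sym (Vec.toList-map (Fin.punchIn h) ρ))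
     (All.map⁺ (All.tabulate (λ _ → punchInᵢ≢i h _ ∘ sym)))
   ∷ subst Unique (sym (Vec.toList-map (Fin.punchIn h) ρ))
     (Unique.map⁺ (punchIn-injective h _ _) (distinct⇒Unique-toList ρ ρ-perm)))

isPerm⇒insertHead : ∀ {m} {σ : Vec (Fin (suc m)) (suc m)} → T (isPerm σ) →
  Σ[ hρ ∈ Fin (suc m) × Vec (Fin m) m ] T (isPerm (proj₂ hρ)) × insertHead hρ ≡ σ
isPerm⇒insertHead {σ = h ∷ t} σ-perm with distinct⇒Unique-toList (h ∷ t) σ-perm
... | h∉t ∷ t! = (h , ρ) , ρ-perm , cong (h ∷_) (punchIn-punchOutAll h t h∉t)
  where
  ρ = punchOutAll h t h∉t
  ρ-perm : T (isPerm ρ)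
  ρ-perm = Unique-toList⇒distinct ρ (Unique.map⁻ (subst Unique (Vec.toList-map (Fin.punchIn h) ρ)
    (subst (Unique ∘ Vec.toList) (sym (punchIn-punchOutAll h t h∉t)) t!)))

Perm[1+m]↔Fin[1+m]×Perm[m] : ∀ m → Perm (suc m) ↔ (Fin (suc m) × Perm m)
Perm[1+m]↔Fin[1+m]×Perm[m] m = Σ-assoc ↔-∘ ↔-sym (Σ↔Σ-by-injection insertHead insertHead-injective
  T-irrelevant T-irrelevant (λ {hρ} → insertHead-isPerm {hρ = hρ}) isPerm⇒insertHead)

Perm↔Fin[m!] : ∀ m → Perm m ↔ Fin (m !)
Perm↔Fin[m!] zero    =
  mk↔ₛ′ (λ _ → Fin.zero) (λ _ → [] , tt) (λ { Fin.zero → refl ; (Fin.suc ()) }) (λ { ([] , tt) → refl })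
Perm↔Fin[m!] (suc m) = ↔-sym *↔× ↔-∘ ((↔-refl ×-↔ Perm↔Fin[m!] m) ↔-∘ Perm[1+m]↔Fin[1+m]×Perm[m] m)

-- Permutations of maximal statistic

module _ (d m : ℕ) where

  private
    N : ℕ
    N = suc d + suc m

    Middle : ℕ → Set
    Middle y = suc d ≤ y × y < suc d + m

  liftMiddle : Fin m → Fin N
  liftMiddle i = suc d ↑ʳ Fin.inject₁ i

  top : Fin N
  top = suc d ↑ʳ Fin.fromℕ m

  initial : Vec (Fin N) (suc d)
  initial = Vec.tabulate (_↑ˡ suc m)

  build : Vec (Fin m) m → Vec (Fin N) N
  build τ = initial Vec.++ (Vec.map liftMiddle τ Vec.∷ʳ top)

  toℕ-liftMiddle : ∀ i → toℕ (liftMiddle i) ≡ suc d + toℕ i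
  toℕ-liftMiddle i = trans (toℕ-↑ʳ (suc d) (Fin.inject₁ i)) (cong (suc d +_) (toℕ-inject₁ i))

  toℕ-top : toℕ top ≡ suc d + m
  toℕ-top = trans (toℕ-↑ʳ (suc d) (Fin.fromℕ m)) (cong (suc d +_) (toℕ-fromℕ m))

  toℕs-initial : toℕs initial ≡ interval 0 (suc d)
  toℕs-initial = toℕs-tabulate 0 (suc d) (_↑ˡ suc m) (λ i → toℕ-↑ˡ i (suc m))

  toℕs-build : ∀ τ → toℕs (build τ) ≡ canonical (suc d) m (toℕs τ)
  toℕs-build τ = begin
    toℕs (build τ)
      ≡⟨ toℕs-++ initial (Vec.map liftMiddle τ Vec.∷ʳ top) ⟩
    toℕs initial ++ toℕs (Vec.map liftMiddle τ Vec.∷ʳ top)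
      ≡⟨ cong (toℕs initial ++_) (toℕs-∷ʳ (Vec.map liftMiddle τ) top) ⟩
    toℕs initial ++ toℕs (Vec.map liftMiddle τ) ∷ʳ toℕ top
      ≡⟨ cong₂ _++_ toℕs-initial
           (cong₂ _∷ʳ_ (toℕs-map liftMiddle (suc d +_) toℕ-liftMiddle τ) toℕ-top) ⟩
    canonical (suc d) m (toℕs τ) ∎
    where open ≡-Reasoning

  build-injective : ∀ {τ τ′} → build τ ≡ build τ′ → τ ≡ τ′
  build-injective e = Vec-map-injective (inject₁-injective ∘ ↑ʳ-injective (suc d) _ _)
    (Vec.∷ʳ-injectiveˡ _ _ (Vec.++-injectiveʳ initial initial e))

  build-isPerm : ∀ {τ} → T (isPerm τ) → T (isPerm (build τ))
  build-isPerm {τ} τ-perm = Unique⇒distinct (subst Unique (sym (toℕs-build τ))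
    (canonical-Unique (suc d) m (distinct⇒Unique (toℕs τ) τ-perm) (toℕs<n τ)))

  build-isPerm⁻ : ∀ τ → T (isPerm (build τ)) → T (isPerm τ)
  build-isPerm⁻ τ build-perm = Unique⇒distinct (canonical-Unique⁻ (suc d) m (toℕs τ)
    (subst Unique (toℕs-build τ) (distinct⇒Unique (toℕs (build τ)) build-perm)))

  build-mmp : ∀ τ → mmp (suc m) (build τ) ≡ N ∸ suc m
  build-mmp τ = begin
    mmpAux (suc m) [] (toℕs (build τ))               ≡⟨ cong (mmpAux (suc m) []) (toℕs-build τ) ⟩
    mmpAux (suc m) [] (canonical (suc d) m (toℕs τ)) ≡⟨ canonical-mmp (suc d) m (length-toℕs τ) (toℕs<n τ) ⟩
    suc d                                            ≡⟨ sym (m+n∸n≡m (suc d) (suc m)) ⟩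
    N ∸ suc m                                        ∎
    where open ≡-Reasoning

  lowerMiddle : (y : Fin N) → Middle (toℕ y) → Fin m
  lowerMiddle y (lo , hi) = fromℕ< (+-cancelˡ-< (suc d) _ _ (subst (_< suc d + m) (sym (m+[n∸m]≡n lo)) hi))

  liftMiddle-lowerMiddle : ∀ y (y-mid : Middle (toℕ y)) → liftMiddle (lowerMiddle y y-mid) ≡ y
  liftMiddle-lowerMiddle y (lo , hi) = toℕ-injective (trans (toℕ-liftMiddle _)
    (trans (cong (suc d +_) (toℕ-fromℕ< _)) (m+[n∸m]≡n lo)))

  lowerAll : ∀ {l} (q : Vec (Fin N) l) → All Middle (toℕs q) → Vec (Fin m) l
  lowerAll []      []              = []
  lowerAll (y ∷ q) (y-mid ∷ q-mid) = lowerMiddle y y-mid ∷ lowerAll q q-mid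

  liftMiddle-lowerAll : ∀ {l} (q : Vec (Fin N) l) q-mid → Vec.map liftMiddle (lowerAll q q-mid) ≡ q
  liftMiddle-lowerAll []      []              = refl
  liftMiddle-lowerAll (y ∷ q) (y-mid ∷ q-mid) =
    cong₂ _∷_ (liftMiddle-lowerMiddle y y-mid) (liftMiddle-lowerAll q q-mid)

  saturated⇒build : ∀ {σ} → T (isPerm σ) × mmp (suc m) σ ≡ N ∸ suc m →
    Σ[ τ ∈ Vec (Fin m) m ] T (isPerm τ) × build τ ≡ σ
  saturated⇒build {σ} (σ-perm , saturated) with Vec.splitAt (suc d) σ
  ... | x ∷ p , r , refl with Vec.initLast r
  ... | q , z , refl = τ , build-isPerm⁻ τ (subst (T ∘ isPerm) (sym build≡σ) σ-perm) , build≡σ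
    where
    xs = toℕs (x ∷ p)
    u = toℕs q
    t = toℕ z
    word≡ : toℕs ((x ∷ p) Vec.++ (q Vec.∷ʳ z)) ≡ xs ++ u ∷ʳ t
    word≡ = trans (toℕs-++ (x ∷ p) (q Vec.∷ʳ z)) (cong (xs ++_) (toℕs-∷ʳ q z))
    unique : Unique (xs ++ u ∷ʳ t)
    unique = subst Unique word≡ (distinct⇒Unique _ σ-perm)
    saturated′ : mmpAux (suc m) [] (xs ++ u ∷ʳ t) ≡ length (xs ++ u ∷ʳ t) ∸ suc m
    saturated′ = subst (λ w → mmpAux (suc m) [] w ≡ length w ∸ suc m) word≡
      (trans saturated (cong (_∸ suc m) (sym (length-toℕs ((x ∷ p) Vec.++ (q Vec.∷ʳ z))))))
    values : xs ≡ interval 0 (suc d) × t ≡ suc d + m × All Middle u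
    values = Extremal-values (length-toℕs (x ∷ p)) (length-toℕs q) unique
      (subst (All (_< N)) word≡ (toℕs<n _))
      (saturated⇒Extremal (proj₁ (AllPairs-++⁻ xs unique))
        (trans (length-∷ʳ u t) (cong suc (length-toℕs q))) saturated′)
    τ = lowerAll q (proj₂ (proj₂ values))
    build≡σ : build τ ≡ (x ∷ p) Vec.++ (q Vec.∷ʳ z)
    build≡σ = cong₂ Vec._++_ (toℕs-injective (trans toℕs-initial (sym (proj₁ values))))
      (cong₂ Vec._∷ʳ_ (liftMiddle-lowerAll q _) (toℕ-injective (trans toℕ-top (sym (proj₁ (proj₂ values))))))

  saturated↔Perm : (Σ[ σ ∈ Vec (Fin N) N ] (T (isPerm σ) × mmp (suc m) σ ≡ N ∸ suc m)) ↔ Perm m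
  saturated↔Perm = ↔-sym (Σ↔Σ-by-injection build build-injective T-irrelevant
    (λ (p , e) (p′ , e′) → cong₂ _,_ (T-irrelevant p p′) (≡-irrelevant e e′))
    (λ {τ} τ-perm → build-isPerm τ-perm , build-mmp τ) saturated⇒build)

k+1≤n⇒n≡1+d+k : ∀ {k n} → k + 1 ≤ n → Σ[ d ∈ ℕ ] n ≡ suc d + k
k+1≤n⇒n≡1+d+k {k} {n} k+1≤n = d , (begin
  n           ≡⟨ sym (m+[n∸m]≡n k+1≤n) ⟩
  k + 1 + d   ≡⟨ +-comm (k + 1) d ⟩
  d + (k + 1) ≡⟨ cong (d +_) (+-comm k 1) ⟩
  d + suc k   ≡⟨ +-suc d k ⟩
  suc d + k   ∎)
  where
  open ≡-Reasoning
  d = n ∸ (k + 1)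

mainTheorem10 : (k : ℕ) → 1 ≤ k → (n : ℕ) → k + 1 ≤ n →
    (Σ[ σ ∈ Vec (Fin n) n ] (T (isPerm σ) × mmp k σ ≡ n ∸ k)) ↔ Fin ((k ∸ 1) !)
mainTheorem10 (suc m) _ n k+1≤n with k+1≤n⇒n≡1+d+k {suc m} k+1≤n
... | d , refl = Perm↔Fin[m!] m ↔-∘ saturated↔Perm d m
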